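{- Let $X$ be a weighted sequence of length $n$ and $\frac1z$ a threshold probability. The solid factor trie $\mathcal{T}$ of $X$ has at most $z$ nodes at each level.
   Context: A weighted sequence $X=x_1\ldots x_n$ over an alphabet $\Sigma$ assigns to each position $i$ and letter $s$ a probability $\pi_i(s)\ge0$ with $\sum_s\pi_i(s)=1$. A string $F$ is a solid factor of $X$ at position $i$ (ending at $j=i+|F|-1\le n$; $F$ may be empty) if $\prod_{k=1}^{|F|}\pi_{i+k-1}(F[k])\ge\frac1z$. The heavy string $\mathbf{X}$ is obtained by choosing at each position a letter of maximum probability (ties broken arbitrarily, but fixed). The extension of a solid factor $F$ starting at $i$ and ending at $j\ge i-1$ is $F\,\mathbf{X}[j+1..n]$; $\mathcal{E}$ is the set of extensions of all solid factors of $X$. A trie is a rooted tree whose edges are labelled by letters of $\Sigma$, with edges going down from one node having distinct labels; for a node $u$ with ancestor $v$, $\mathrm{str}(u,v)$ is the string of edge labels read along the path from $u$ up to $v$, and the trie represents the family $\{\mathrm{str}(u,\mathrm{root})\}$. The solid factor trie $\mathcal{T}$ of $X$ is the trie representing the reversals of the strings of $\mathcal{E}$, i.e. $\{\mathrm{str}(u,\mathrm{root}):u\in\mathcal{T}\}=\mathcal{E}$. Level $i$ of a trie is the set of nodes at depth $i$.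
   Formalization: The probabilities $\pi_i(s)$ of the weighted sequence and the threshold parameter z take rational values. -}

module Defs where

open import Data.Nat using (ℕ) renaming (_≤_ to _≤ℕ_; _+_ to _+ℕ_)
open import Data.Fin using (Fin)
open import Data.List using (List; []; _∷_; _++_; length; map; foldr; zipWith; drop; allFin)
open import Data.Product using (Σ; _×_)
open import Data.Rational using (ℚ; 0ℚ; 1ℚ; _+_; _*_; _≤_; 1/_; NonZero)
open import Relation.Binary.PropositionalEquality using (_≡_)

-- A weighted sequence of length n over the alphabet Fin σ:
-- positions are 0-indexed (Fin n); π i s is the probability of letter s at position i.
WSeq : ℕ → ℕ → Set
WSeq σ n = Fin n → Fin σ → ℚ

IsWeightedSeq : (σ n : ℕ) → WSeq σ n → Set
IsWeightedSeq σ n π =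
  ((i : Fin n) (s : Fin σ) → 0ℚ ≤ π i s) ×
  ((i : Fin n) → foldr _+_ 0ℚ (map (π i) (allFin σ)) ≡ 1ℚ)

-- Probability of the string F occurring starting at (0-indexed) position i:
-- product of π (i+k) (F[k]) over k.  Only meaningful when i + |F| ≤ n.
occProb : (σ n : ℕ) → WSeq σ n → ℕ → List (Fin σ) → ℚ
occProb σ n π i F = foldr _*_ 1ℚ (zipWith π (drop i (allFin n)) F)

-- F is a solid factor of X starting at (0-indexed) position i
-- (F may be empty; i + |F| ≤ n, i.e. it ends at j ≤ n in 1-indexed terms).
SolidFactor : (σ n : ℕ) → WSeq σ n → (z : ℚ) → .{{_ : NonZero z}} →
              ℕ → List (Fin σ) → Set
SolidFactor σ n π z i F = (i +ℕ length F ≤ℕ n) × (1/ z ≤ occProb σ n π i F)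

-- H is a heavy string of X: at each position a letter of maximum probability
-- (an arbitrary but fixed tie-breaking is modelled by quantifying over all such H).
IsHeavy : (σ n : ℕ) → WSeq σ n → (Fin n → Fin σ) → Set
IsHeavy σ n π H = (i : Fin n) (s : Fin σ) → π i s ≤ π i (H i)

extension : (σ n : ℕ) → (Fin n → Fin σ) → ℕ → List (Fin σ) → List (Fin σ)
extension σ n H i F = F ++ map H (drop (i +ℕ length F) (allFin n))

InE : (σ n : ℕ) → WSeq σ n → (z : ℚ) → .{{_ : NonZero z}} →
      (Fin n → Fin σ) → List (Fin σ) → Set
InE σ n π z H e =
  Σ ℕ λ i → Σ (List (Fin σ)) λ F →
    SolidFactor σ n π z i F × (e ≡ extension σ n H i F)

-- Nodes at level d of the solid factor trie T: since T represents exactly the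
-- reversals of the strings of E, a node u at depth d is determined by
-- str(u, root), a string of E of length d, and distinct nodes give distinct strings.
LevelNode : (σ n : ℕ) → WSeq σ n → (z : ℚ) → .{{_ : NonZero z}} →
            (Fin n → Fin σ) → ℕ → List (Fin σ) → Set
LevelNode σ n π z H d e = (length e ≡ d) × InE σ n π z H e

module Submission where

open import Defs
open import Data.Nat using (ℕ)
open import Data.Fin using (Fin)
open import Data.List using (List; length)
open import Data.List.Relation.Unary.All using (All)
open import Data.List.Relation.Unary.Unique.Propositional using (Unique)
open import Data.Integer using (+_)
open import Data.Rational using (ℚ; 1ℚ; _≤_; _/_; NonZero)

open import Data.Bool using (if_then_else_)
open import Data.Empty using (⊥-elim)
open import Data.Fin using (_≟_)
open import Data.Integer using () renaming (_+_ to _+ℤ_; _*_ to _*ℤ_)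
import Data.Integer.Properties as ℤ
open import Data.List using ([]; _∷_; _++_; map; foldr; zipWith; drop; allFin)
import Data.List.Properties as List
import Data.List.Relation.Unary.All as All
open import Data.List.Relation.Unary.All using ([]; _∷_)
open import Data.List.Relation.Unary.AllPairs using ([]; _∷_)
open import Data.List.Relation.Unary.Any using (here; there)
open import Data.List.Membership.Propositional using (_∈_)
open import Data.List.Membership.Propositional.Properties using (∈-allFin)
open import Data.List.Relation.Unary.Unique.Propositional.Properties using (allFin⁺)
open import Data.Nat using (suc; _∸_; z≤n; s≤s) renaming (_≤_ to _≤ℕ_; _+_ to _+ℕ_)
import Data.Nat.Properties as ℕ
open import Data.Nat.Coprimality using (1-coprimeTo) renaming (sym to coprime-sym)
open import Data.Product using (Σ; _×_; _,_; proj₁; proj₂)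
open import Data.Rational using (0ℚ; _+_; _*_; 1/_; _≤?_; nonNegative)
open import Data.Rational.Properties hiding (_≟_)
open import Relation.Binary.PropositionalEquality
open import Relation.Nullary using (¬_; does; yes; no)

-- Fix the level d and the start position i = n ∸ d; every
-- node at level d is the extension F · H[i+|F|..] of a solid factor F
-- starting at i.  Abstractly, the positions i, …, n−1 form a list of
-- columns (a distribution p together with a heavy letter h).  Call a string
-- e reachable with budget a and threshold t if e = F · (heavy letters) for
-- a prefix F with t ≤ a · Prob(F).  The counting lemma `reachable-mass`
-- says that k distinct reachable strings satisfy k · t ≤ a.  It is proved
-- by induction on the columns: if t > a · p(h) no nonempty F qualifies
-- (each letter has probability ≤ p(h)), so only the all-heavy string is
-- reachable; otherwise the strings are grouped by their first letter c, the
-- tails in group c are reachable in the remaining columns with budget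
-- a · p(c), and the bounds add up to Σ_c a · p(c) = a.  The theorem is the
-- instance a = 1, t = 1/z, which gives (number of nodes) / z ≤ 1.

*-monoˡ-≤-≥0 : ∀ {r p q} → 0ℚ ≤ r → p ≤ q → r * p ≤ r * q
*-monoˡ-≤-≥0 {r} r≥0 = *-monoˡ-≤-nonNeg r {{nonNegative r≥0}}

*-≥0 : ∀ {p q} → 0ℚ ≤ p → 0ℚ ≤ q → 0ℚ ≤ p * q
*-≥0 {p} {q} p≥0 q≥0 =
  nonNegative⁻¹ (p * q) {{nonNeg*nonNeg⇒nonNeg p {{nonNegative p≥0}} q {{nonNegative q≥0}}}}

≤-+-≥0ˡ : ∀ {p q} → 0ℚ ≤ p → q ≤ p + q
≤-+-≥0ˡ {p} {q} p≥0 = subst (_≤ p + q) (+-identityˡ q) (+-monoˡ-≤ q p≥0)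

≤-+-≥0ʳ : ∀ {p q} → 0ℚ ≤ q → p ≤ p + q
≤-+-≥0ʳ {p} {q} q≥0 = subst (_≤ p + q) (+-identityʳ p) (+-monoʳ-≤ p q≥0)

*-≤1 : ∀ {p q} → 0ℚ ≤ p → q ≤ 1ℚ → p * q ≤ p
*-≤1 {p} p≥0 q≤1 = subst (p * _ ≤_) (*-identityʳ p) (*-monoˡ-≤-≥0 p≥0 q≤1)

ℕ→ℚ-suc : ∀ m → 1ℚ + + m / 1 ≡ + suc m / 1
ℕ→ℚ-suc m = trans
  (cong (λ q → 1ℚ + q) (normalize-coprime {m} {0} (coprime-sym (1-coprimeTo m))))
  (/-cong {+ 1 *ℤ + 1 +ℤ + m *ℤ + 1} {1} {+ suc m} {1}
          (cong (+ 1 +ℤ_) (ℤ.*-identityʳ (+ m))) refl)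

≤-from-*-reciprocal : ∀ k z .{{_ : NonZero z}} → 0ℚ ≤ z → k * 1/ z ≤ 1ℚ → k ≤ z
≤-from-*-reciprocal k z z≥0 k/z≤1 = begin
  k              ≡⟨ sym (*-identityʳ k) ⟩
  k * 1ℚ         ≡⟨ cong (k *_) (sym (*-inverseˡ z)) ⟩
  k * (1/ z * z) ≡⟨ sym (*-assoc k (1/ z) z) ⟩
  k * 1/ z * z   ≤⟨ *-monoʳ-≤-nonNeg z {{nonNegative z≥0}} k/z≤1 ⟩
  1ℚ * z         ≡⟨ *-identityˡ z ⟩
  z              ∎
  where open ≤-Reasoning

∑ : ∀ {A : Set} → List A → (A → ℚ) → ℚ
∑ xs g = foldr _+_ 0ℚ (map g xs)

∑-cong : ∀ {A : Set} (xs : List A) {g h : A → ℚ} → (∀ x → g x ≡ h x) → ∑ xs g ≡ ∑ xs h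
∑-cong []       g≡h = refl
∑-cong (x ∷ xs) g≡h = cong₂ _+_ (g≡h x) (∑-cong xs g≡h)

∑-+ : ∀ {A : Set} (xs : List A) (g h : A → ℚ) → ∑ xs (λ x → g x + h x) ≡ ∑ xs g + ∑ xs h
∑-+ []       g h = sym (+-identityʳ 0ℚ)
∑-+ (x ∷ xs) g h = begin
  (g x + h x) + ∑ xs (λ y → g y + h y) ≡⟨ cong (λ q → (g x + h x) + q) (∑-+ xs g h) ⟩
  (g x + h x) + (∑ xs g + ∑ xs h)      ≡⟨ +-assoc (g x) (h x) _ ⟩
  g x + (h x + (∑ xs g + ∑ xs h))      ≡⟨ cong (λ q → g x + q) (sym (+-assoc (h x) _ _)) ⟩
  g x + ((h x + ∑ xs g) + ∑ xs h)      ≡⟨ cong (λ w → g x + (w + ∑ xs h)) (+-comm (h x) _) ⟩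
  g x + ((∑ xs g + h x) + ∑ xs h)      ≡⟨ cong (λ q → g x + q) (+-assoc (∑ xs g) _ _) ⟩
  g x + (∑ xs g + (h x + ∑ xs h))      ≡⟨ sym (+-assoc (g x) _ _) ⟩
  (g x + ∑ xs g) + (h x + ∑ xs h)      ∎
  where open ≡-Reasoning

∑-*ˡ : ∀ {A : Set} (xs : List A) (a : ℚ) (g : A → ℚ) → ∑ xs (λ x → a * g x) ≡ a * ∑ xs g
∑-*ˡ []       a g = sym (*-zeroʳ a)
∑-*ˡ (x ∷ xs) a g = trans (cong (λ q → a * g x + q) (∑-*ˡ xs a g)) (sym (*-distribˡ-+ a (g x) _))

∑-mono-≤ : ∀ {A : Set} (xs : List A) {g h : A → ℚ} → (∀ x → g x ≤ h x) → ∑ xs g ≤ ∑ xs h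
∑-mono-≤ []       g≤h = ≤-refl
∑-mono-≤ (x ∷ xs) g≤h = +-mono-≤ (g≤h x) (∑-mono-≤ xs g≤h)

∑-zero : ∀ {A : Set} (xs : List A) → ∑ xs (λ _ → 0ℚ) ≡ 0ℚ
∑-zero []       = refl
∑-zero (x ∷ xs) = trans (+-identityˡ _) (∑-zero xs)

∑-≥0 : ∀ {A : Set} (xs : List A) {g : A → ℚ} → (∀ x → 0ℚ ≤ g x) → 0ℚ ≤ ∑ xs g
∑-≥0 []       g≥0 = ≤-refl
∑-≥0 (x ∷ xs) g≥0 = ≤-trans (∑-≥0 xs g≥0) (≤-+-≥0ˡ (g≥0 x))

∑-member : ∀ {A : Set} (xs : List A) {g : A → ℚ} {y} →
           (∀ x → 0ℚ ≤ g x) → y ∈ xs → g y ≤ ∑ xs g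
∑-member (x ∷ xs) g≥0 (here refl) = ≤-+-≥0ʳ (∑-≥0 xs g≥0)
∑-member (x ∷ xs) g≥0 (there y∈) = ≤-trans (∑-member xs g≥0 y∈) (≤-+-≥0ˡ (g≥0 x))

δ : ∀ {σ} → Fin σ → Fin σ → ℚ → ℚ
δ x c t = if does (x ≟ c) then t else 0ℚ

∑-δ-absent : ∀ {σ} (cs : List (Fin σ)) (x : Fin σ) (t : ℚ) →
             All (λ c → ¬ x ≡ c) cs → ∑ cs (λ c → δ x c t) ≡ 0ℚ
∑-δ-absent []       x t []          = refl
∑-δ-absent (c ∷ cs) x t (x≢c ∷ x∉) with x ≟ c
... | yes x≡c = ⊥-elim (x≢c x≡c)
... | no  _   = trans (+-identityˡ _) (∑-δ-absent cs x t x∉)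

∑-δ : ∀ {σ} (cs : List (Fin σ)) (x : Fin σ) (t : ℚ) →
      Unique cs → x ∈ cs → ∑ cs (λ c → δ x c t) ≡ t
∑-δ (c ∷ cs) x t (c∉ ∷ _) (here refl) with x ≟ x
... | yes _   = trans (cong (λ q → t + q) (∑-δ-absent cs x t c∉))
                      (+-identityʳ t)
... | no  x≢x = ⊥-elim (x≢x refl)
∑-δ (c ∷ cs) x t (c∉ ∷ u) (there x∈) with x ≟ c
... | yes refl = ⊥-elim (All.lookup c∉ x∈ refl)
... | no  _    = trans (+-identityˡ _) (∑-δ cs x t u x∈)

mass : ∀ {A : Set} → ℚ → List A → ℚ
mass t []       = 0ℚ
mass t (_ ∷ es) = t + mass t es

mass-length : ∀ {A : Set} (t : ℚ) (es : List A) → mass t es ≡ (+ length es / 1) * t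
mass-length t []       = sym (*-zeroˡ t)
mass-length t (e ∷ es) = begin
  t + mass t es                       ≡⟨ cong₂ _+_ (sym (*-identityˡ t)) (mass-length t es) ⟩
  1ℚ * t + (+ length es / 1) * t      ≡⟨ sym (*-distribʳ-+ t 1ℚ (+ length es / 1)) ⟩
  (1ℚ + + length es / 1) * t          ≡⟨ cong (_* t) (ℕ→ℚ-suc (length es)) ⟩
  (+ suc (length es) / 1) * t         ∎
  where open ≡-Reasoning

branch : ∀ {σ} → Fin σ → List (List (Fin σ)) → List (List (Fin σ))
branch c []             = []
branch c ([] ∷ es)      = branch c es
branch c ((x ∷ w) ∷ es) = if does (x ≟ c) then w ∷ branch c es else branch c es

branch-∈ : ∀ {σ} {c : Fin σ} (es : List (List (Fin σ))) {w} → w ∈ branch c es → (c ∷ w) ∈ es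
branch-∈         ([] ∷ es)      w∈ = there (branch-∈ es w∈)
branch-∈ {c = c} ((x ∷ v) ∷ es) w∈ with x ≟ c
branch-∈         ((x ∷ v) ∷ es) (here refl) | yes refl = here refl
branch-∈         ((x ∷ v) ∷ es) (there w∈)  | yes refl = there (branch-∈ es w∈)
branch-∈         ((x ∷ v) ∷ es) w∈          | no  _    = there (branch-∈ es w∈)

branch-unique : ∀ {σ} (c : Fin σ) (es : List (List (Fin σ))) → Unique es → Unique (branch c es)
branch-unique c []             []          = []
branch-unique c ([] ∷ es)      (_ ∷ u)     = branch-unique c es u
branch-unique c ((x ∷ v) ∷ es) (v∉ ∷ u) with x ≟ c
... | yes refl = All.tabulate (λ w∈ v≡w → All.lookup v∉ (branch-∈ es w∈) (cong (x ∷_) v≡w))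
                   ∷ branch-unique c es u
... | no  _    = branch-unique c es u

mass-branch-∷ : ∀ {σ} (t : ℚ) (x c : Fin σ) (v : List (Fin σ)) (es : List (List (Fin σ))) →
                mass t (branch c ((x ∷ v) ∷ es)) ≡ δ x c t + mass t (branch c es)
mass-branch-∷ t x c v es with x ≟ c
... | yes _ = refl
... | no  _ = sym (+-identityˡ _)

data NonEmpty {A : Set} : List A → Set where
  nonEmpty : ∀ {x xs} → NonEmpty (x ∷ xs)

-- Each nonempty string lies in exactly one branch, so masses add up.
mass-split : ∀ {σ} (t : ℚ) (es : List (List (Fin σ))) → All NonEmpty es →
             mass t es ≡ ∑ (allFin σ) (λ c → mass t (branch c es))
mass-split {σ} t []             []               = sym (∑-zero (allFin σ))
mass-split {σ} t ((x ∷ v) ∷ es) (nonEmpty ∷ ne) = begin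
  t + mass t es
    ≡⟨ cong₂ _+_ (sym (∑-δ (allFin σ) x t (allFin⁺ σ) (∈-allFin x))) (mass-split t es ne) ⟩
  ∑ (allFin σ) (λ c → δ x c t) + ∑ (allFin σ) (λ c → mass t (branch c es))
    ≡⟨ sym (∑-+ (allFin σ) _ _) ⟩
  ∑ (allFin σ) (λ c → δ x c t + mass t (branch c es))
    ≡⟨ ∑-cong (allFin σ) (λ c → sym (mass-branch-∷ t x c v es)) ⟩
  ∑ (allFin σ) (λ c → mass t (branch c ((x ∷ v) ∷ es)))
    ∎
  where open ≡-Reasoning

mass-of-copies : ∀ {σ} {es : List (List (Fin σ))} {s : List (Fin σ)} {t a : ℚ} →
                 Unique es → All (λ e → (e ≡ s) × (t ≤ a)) es → 0ℚ ≤ a → mass t es ≤ a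
mass-of-copies {es = []}          _ _ a≥0 = a≥0
mass-of-copies {es = e ∷ []} {t = t} _ ((_ , t≤a) ∷ []) _ = subst (_≤ _) (sym (+-identityʳ t)) t≤a
mass-of-copies {es = e ∷ e′ ∷ _} ((e≢e′ ∷ _) ∷ _) ((e≡s , _) ∷ (e′≡s , _) ∷ _) _ =
  ⊥-elim (e≢e′ (trans e≡s (sym e′≡s)))

Column : ℕ → Set
Column σ = (Fin σ → ℚ) × Fin σ

IsColumn : ∀ {σ} → Column σ → Set
IsColumn {σ} (p , h) =
  (∀ s → 0ℚ ≤ p s) × (∀ s → p s ≤ 1ℚ) × (∀ s → p s ≤ p h) × (∑ (allFin σ) p ≡ 1ℚ)

heavy : ∀ {σ} → List (Column σ) → List (Fin σ)
heavy cs = map proj₂ cs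

-- Probability of F at the start of the columns (extra letters are ignored).
prob : ∀ {σ} → List (Column σ) → List (Fin σ) → ℚ
prob cs             []      = 1ℚ
prob []             (c ∷ F) = 1ℚ
prob ((p , _) ∷ cs) (c ∷ F) = p c * prob cs F

extend : ∀ {σ} → List (Column σ) → List (Fin σ) → List (Fin σ)
extend cs       []      = heavy cs
extend []       (c ∷ F) = c ∷ F
extend (_ ∷ cs) (c ∷ F) = c ∷ extend cs F

Reachable : ∀ {σ} → List (Column σ) → (a t : ℚ) → List (Fin σ) → Set
Reachable {σ} cs a t e =
  Σ (List (Fin σ)) λ F → (length F ≤ℕ length cs) × (t ≤ a * prob cs F) × (e ≡ extend cs F)

-- Prob(F) is a probability; the upper bound drives the threshold case.
prob-bounds : ∀ {σ} (cs : List (Column σ)) (F : List (Fin σ)) → All IsColumn cs →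
              (0ℚ ≤ prob cs F) × (prob cs F ≤ 1ℚ)
prob-bounds cs             []      _ = nonNegative⁻¹ 1ℚ , ≤-refl
prob-bounds []             (c ∷ F) _ = nonNegative⁻¹ 1ℚ , ≤-refl
prob-bounds ((p , h) ∷ cs) (c ∷ F) ((p≥0 , p≤1 , _ , _) ∷ ok) =
  *-≥0 (p≥0 c) (proj₁ (prob-bounds cs F ok)) ,
  ≤-trans (*-≤1 (p≥0 c) (proj₂ (prob-bounds cs F ok))) (p≤1 c)

reachable-heavy : ∀ {σ} {p : Fin σ → ℚ} {h cs a t e} → IsColumn (p , h) → All IsColumn cs →
                  0ℚ ≤ a → ¬ t ≤ a * p h → Reachable ((p , h) ∷ cs) a t e →
                  (e ≡ heavy ((p , h) ∷ cs)) × (t ≤ a)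
reachable-heavy {a = a} {t} _ _ _ _ ([] , _ , t≤a , e≡) = e≡ , subst (t ≤_) (*-identityʳ a) t≤a
reachable-heavy {p = p} {h} {cs} (p≥0 , _ , p≤ph , _) ok a≥0 t≰ (c ∷ F , _ , t≤ , _) =
  ⊥-elim (t≰ (≤-trans t≤ (*-monoˡ-≤-≥0 a≥0 letter≤heavy)))
  where
  letter≤heavy : p c * prob cs F ≤ p h
  letter≤heavy = ≤-trans (*-≤1 (p≥0 c) (proj₂ (prob-bounds cs F ok))) (p≤ph c)

reachable-tail : ∀ {σ} {p : Fin σ → ℚ} {h cs a t c w} → t ≤ a * p h →
                 Reachable ((p , h) ∷ cs) a t (c ∷ w) → Reachable cs (a * p c) t w
reachable-tail {p = p} {h} {a = a} {t} t≤ ([] , _ , _ , refl) =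
  [] , z≤n , subst (t ≤_) (sym (*-identityʳ (a * p h))) t≤ , refl
reachable-tail {p = p} {cs = cs} {a} {t} _ (c ∷ F , s≤s |F|≤ , t≤ , refl) =
  F , |F|≤ , subst (t ≤_) (sym (*-assoc a (p c) (prob cs F))) t≤ , refl

reachable-nonEmpty : ∀ {σ} {col : Column σ} {cs a t e} → Reachable (col ∷ cs) a t e → NonEmpty e
reachable-nonEmpty ([]    , _ , _ , refl) = nonEmpty
reachable-nonEmpty (_ ∷ _ , _ , _ , refl) = nonEmpty

reachable-mass : ∀ {σ} (cs : List (Column σ)) → All IsColumn cs → (a t : ℚ) → 0ℚ ≤ a →
                 (es : List (List (Fin σ))) → Unique es → All (Reachable cs a t) es →
                 mass t es ≤ a
reachable-mass [] _ a t a≥0 es u reach = mass-of-copies u (All.map onlyEmpty reach) a≥0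
  where
  onlyEmpty : ∀ {e} → Reachable [] a t e → (e ≡ []) × (t ≤ a)
  onlyEmpty ([] , _ , t≤a , e≡) = e≡ , subst (t ≤_) (*-identityʳ a) t≤a
reachable-mass {σ} ((p , h) ∷ cs) (col@(p≥0 , _ , _ , ∑p≡1) ∷ ok) a t a≥0 es u reach
  with t ≤? a * p h
... | no t≰ = mass-of-copies u (All.map (reachable-heavy col ok a≥0 t≰) reach) a≥0
... | yes t≤ = begin
  mass t es                                ≡⟨ mass-split t es (All.map (reachable-nonEmpty {a = a}) reach) ⟩
  ∑ (allFin σ) (λ c → mass t (branch c es)) ≤⟨ ∑-mono-≤ (allFin σ) branch-mass ⟩
  ∑ (allFin σ) (λ c → a * p c)             ≡⟨ ∑-*ˡ (allFin σ) a p ⟩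
  a * ∑ (allFin σ) p                       ≡⟨ cong (a *_) ∑p≡1 ⟩
  a * 1ℚ                                   ≡⟨ *-identityʳ a ⟩
  a                                        ∎
  where
  open ≤-Reasoning
  branch-mass : ∀ c → mass t (branch c es) ≤ a * p c
  branch-mass c = reachable-mass cs ok (a * p c) t (*-≥0 a≥0 (p≥0 c))
    (branch c es) (branch-unique c es u)
    (All.tabulate (λ w∈ → reachable-tail {a = a} t≤ (All.lookup reach (branch-∈ es w∈))))

-- Translation from weighted sequences: the positions k, k+1, … of X
-- become columns, solid factors become reachable strings.

module FromSequence (σ n : ℕ) (π : WSeq σ n) (H : Fin n → Fin σ) where

  column : Fin n → Column σ
  column k = π k , H k

  columnsFrom : ℕ → List (Column σ)
  columnsFrom i = map column (drop i (allFin n))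

  occProb-prob : (ks : List (Fin n)) (F : List (Fin σ)) →
                 foldr _*_ 1ℚ (zipWith π ks F) ≡ prob (map column ks) F
  occProb-prob []       []      = refl
  occProb-prob []       (c ∷ F) = refl
  occProb-prob (k ∷ ks) []      = refl
  occProb-prob (k ∷ ks) (c ∷ F) = cong (π k c *_) (occProb-prob ks F)

  extension-extend : (ks : List (Fin n)) (F : List (Fin σ)) →
                     F ++ map H (drop (length F) ks) ≡ extend (map column ks) F
  extension-extend ks       []      = List.map-∘ ks
  extension-extend []       (c ∷ F) = cong (c ∷_) (List.++-identityʳ F)
  extension-extend (k ∷ ks) (c ∷ F) = cong (c ∷_) (extension-extend ks F)

  columns-valid : IsWeightedSeq σ n π → IsHeavy σ n π H →
                  (ks : List (Fin n)) → All IsColumn (map column ks)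
  columns-valid _                   _     []       = []
  columns-valid w@(π≥0 , ∑π≡1) heavy? (k ∷ ks) =
    (π≥0 k , π≤1 , heavy? k , ∑π≡1 k) ∷ columns-valid w heavy? ks
    where
    π≤1 : ∀ s → π k s ≤ 1ℚ
    π≤1 s = subst (π k s ≤_) (∑π≡1 k) (∑-member (allFin σ) (π≥0 k) (∈-allFin s))

  length-allFin : length (allFin n) ≡ n
  length-allFin = List.length-tabulate (λ k → k)

  length-columnsFrom : ∀ i → length (columnsFrom i) ≡ n ∸ i
  length-columnsFrom i = trans (List.length-map column (drop i (allFin n)))
    (trans (List.length-drop i (allFin n)) (cong (_∸ i) length-allFin))

  length-extension : ∀ i (F : List (Fin σ)) → i +ℕ length F ≤ℕ n →
                     length (extension σ n H i F) ≡ n ∸ i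
  length-extension i F i+f≤n = begin
    length (F ++ map H (drop (i +ℕ f) (allFin n)))  ≡⟨ List.length-++ F ⟩
    f +ℕ length (map H (drop (i +ℕ f) (allFin n))) ≡⟨ cong (f +ℕ_) (List.length-map H (drop (i +ℕ f) (allFin n))) ⟩
    f +ℕ length (drop (i +ℕ f) (allFin n))         ≡⟨ cong (f +ℕ_) (List.length-drop (i +ℕ f) _) ⟩
    f +ℕ (length (allFin n) ∸ (i +ℕ f))            ≡⟨ cong (λ m → f +ℕ (m ∸ (i +ℕ f))) length-allFin ⟩
    f +ℕ (n ∸ (i +ℕ f))                            ≡⟨ cong (f +ℕ_) (sym (ℕ.∸-+-assoc n i f)) ⟩
    f +ℕ (n ∸ i ∸ f)                               ≡⟨ ℕ.m+[n∸m]≡n f≤n∸i ⟩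
    n ∸ i                                          ∎
    where
    open ≡-Reasoning
    f = length F
    f≤n∸i : f ≤ℕ n ∸ i
    f≤n∸i = ℕ.m+n≤o⇒m≤o∸n f (subst (_≤ℕ n) (ℕ.+-comm i f) i+f≤n)

  solidFactor-reachable : (z : ℚ) .{{_ : NonZero z}} (i : ℕ) (F : List (Fin σ)) →
                          SolidFactor σ n π z i F →
                          Reachable (columnsFrom i) 1ℚ (1/ z) (extension σ n H i F)
  solidFactor-reachable z i F (i+f≤n , solid) =
    F ,
    subst (length F ≤ℕ_) (sym (length-columnsFrom i))
          (ℕ.m+n≤o⇒m≤o∸n (length F) (subst (_≤ℕ n) (ℕ.+-comm i _) i+f≤n)) ,
    subst (1/ z ≤_) (trans (occProb-prob ks F) (sym (*-identityˡ _))) solid ,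
    trans (cong (λ ks′ → F ++ map H ks′) (sym (List.drop-drop i (length F) (allFin n))))
          (extension-extend ks F)
    where
    ks = drop i (allFin n)

  levelNode-reachable : (z : ℚ) .{{_ : NonZero z}} (d : ℕ) {e : List (Fin σ)} →
                        LevelNode σ n π z H d e → Reachable (columnsFrom (n ∸ d)) 1ℚ (1/ z) e
  levelNode-reachable z d (|e|≡d , i , F , sf@(i+f≤n , _) , refl) =
    subst (λ j → Reachable (columnsFrom j) 1ℚ (1/ z) (extension σ n H i F)) (sym start≡i)
          (solidFactor-reachable z i F sf)
    where
    start≡i : n ∸ d ≡ i
    start≡i = trans (cong (n ∸_) (trans (sym |e|≡d) (length-extension i F i+f≤n)))
                    (ℕ.m∸[m∸n]≡n (ℕ.m+n≤o⇒m≤o i i+f≤n))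

lemma7 : (σ n : ℕ) (π : WSeq σ n) → IsWeightedSeq σ n π →
    (z : ℚ) .{{_ : NonZero z}} → 1ℚ ≤ z →
    (H : Fin n → Fin σ) → IsHeavy σ n π H →
    (d : ℕ) (nodes : List (List (Fin σ))) →
    Unique nodes → All (LevelNode σ n π z H d) nodes →
    (+ length nodes) / 1 ≤ z
lemma7 σ n π weighted z 1≤z H heavy? d nodes distinct levelNodes =
  ≤-from-*-reciprocal (+ length nodes / 1) z (≤-trans (nonNegative⁻¹ 1ℚ) 1≤z)
    (subst (_≤ 1ℚ) (mass-length (1/ z) nodes) nodes-mass)
  where
  open FromSequence σ n π H
  nodes-mass : mass (1/ z) nodes ≤ 1ℚ
  nodes-mass = reachable-mass (columnsFrom (n ∸ d)) (columns-valid weighted heavy? _)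
    1ℚ (1/ z) (nonNegative⁻¹ 1ℚ) nodes distinct
    (All.map (levelNode-reachable z d) levelNodes)
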